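{- (Relative Completeness.) Let $\Omega$ be the set of all semantically valid triples $\langle\varphi\rangle\, a\,\langle\psi\rangle$ with $a\in\mathsf{Act}$. For every well-formed program $C$ and all outcome assertions $\varphi,\psi$: if $\models\langle\varphi\rangle\, C\,\langle\psi\rangle$, then $\Omega\vdash\langle\varphi\rangle\, C\,\langle\psi\rangle$.
   Context: Semiring: $\mathcal A=\langle U,+,\cdot,\mathbf 0,\mathbf 1\rangle$ is a partial semiring: $\langle U,+,\mathbf 0\rangle$ is a commutative monoid whose operation $+$ may be partial, $\langle U,\cdot,\mathbf 1\rangle$ is a (total) monoid, $\cdot$ distributes over $+$ on both sides, and $\mathbf 0\cdot u=u\cdot\mathbf 0=\mathbf 0$. It is assumed naturally ordered (the relation $u\le v$ iff $\exists w.\,u+w=v$ is a partial order), Scott continuous (for every directed $D$: $\sup_{x\in D}(x+y)=(\sup D)+y$, $\sup_{x\in D}(x\cdot y)=(\sup D)\cdot y$, $\sup_{x\in D}(y\cdot x)=y\cdot\sup D$), and to have a top element. For a family $(u_i)_{i\in I}$, $\sum_{i\in I}u_i$ is the supremum of all finite partial sums. Weighting functions: $\mathcal W(\Sigma)$ is the set of $m:\Sigma\to U$ with countable support $\mathrm{supp}(m)=\{\sigma: m(\sigma)\neq\mathbf 0\}$ and defined mass $|m|=\sum_{\sigma\in\mathrm{supp}(m)}m(\sigma)$; operations pointwise; $\eta(\sigma)$ is the point mass at $\sigma$ with weight $\mathbf 1$; $f^\dagger(m)(\tau)=\sum_{\sigma\in\mathrm{supp}(m)}m(\sigma)\cdot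 f(\sigma)(\tau)$. Programs: $C::=\mathsf{skip}\mid C_1;C_2\mid C_1+C_2\mid \mathsf{assume}\ e\mid C^{\langle e,e'\rangle}\mid a$, $a\in\mathsf{Act}$; $e::=b\mid u$ ($u\in U$); tests $b$ built from primitive tests $t\subseteq\Sigma$ by $\mathsf{true},\mathsf{false},\lor,\land,\neg$, evaluated Booleanly to $\{\mathbf 0,\mathbf 1\}$; $[\![u]\!](\sigma)=u$. Semantics: $[\![\mathsf{skip}]\!]=\eta$, $[\![C_1;C_2]\!](\sigma)=[\![C_2]\!]^\dagger([\![C_1]\!](\sigma))$, $[\![C_1+C_2]\!](\sigma)=[\![C_1]\!](\sigma)+[\![C_2]\!](\sigma)$, $[\![\mathsf{assume}\ e]\!](\sigma)=[\![e]\!](\sigma)\cdot\eta(\sigma)$, $[\![a]\!]:\Sigma\to\mathcal W(\Sigma)$ given, $[\![C^{\langle e,e'\rangle}]\!]$ the least fixed point of $\Phi(f)(\sigma)=[\![e]\!](\sigma)\cdot f^\dagger([\![C]\!](\sigma))+[\![e']\!](\sigma)\cdot\eta(\sigma)$. Well-formed = total semantics. Assertions: subsets $\varphi\subseteq\mathcal W(\Sigma)$. $\top=\mathcal W(\Sigma)$, $\bot=\emptyset$, $\land=\cap$, $\lor=\cup$, $\exists x{:}T.\phi(x)=\bigcup_{t\in T}\phi(t)$; $\bigoplus_{x\in T}\phi(x)=\{\sum_{t\in T}m_t: m_t\in\phi(t)\}$, binary $\oplus$; $u\odot\varphi=\{u\cdot m:m\in\varphi\}$, $\varphi\odot u=\{m\cdot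 u:m\in\varphi\}$. $\varphi\models e=u$: for all $m\in\varphi$, $\sigma\in\mathrm{supp}(m)$, $[\![e]\!](\sigma)=u$. $(\psi_n)_{n\in\mathbb N}$ converges to $\psi_\infty$ if $m_n\in\psi_n$ for all $n$ implies $\sum_n m_n\in\psi_\infty$. Validity: $\models\langle\varphi\rangle C\langle\psi\rangle$ iff $[\![C]\!]^\dagger(m)\in\psi$ for all $m\in\varphi$. Proof system: $\Gamma\vdash\langle\varphi\rangle C\langle\psi\rangle$ means derivable from the axioms $\Gamma$ with the rules: (Skip) $\langle\varphi\rangle\mathsf{skip}\langle\varphi\rangle$; (Seq) from $\langle\varphi\rangle C_1\langle\vartheta\rangle$, $\langle\vartheta\rangle C_2\langle\psi\rangle$ infer $\langle\varphi\rangle C_1;C_2\langle\psi\rangle$; (Plus) from $\langle\varphi\rangle C_i\langle\psi_i\rangle$ ($i=1,2$) infer $\langle\varphi\rangle C_1+C_2\langle\psi_1\oplus\psi_2\rangle$; (Assume) if $\varphi\models e=u$ then $\langle\varphi\rangle\mathsf{assume}\ e\langle\varphi\odot u\rangle$; (Iter) if $(\psi_n)$ converges to $\psi_\infty$ and for all $n$, $\langle\varphi_n\rangle\mathsf{assume}\ e;C\langle\varphi_{n+1}\rangle$ and $\langle\varphi_n\rangle\mathsf{assume}\ e'\langle\psi_n\rangle$, then $\langle\varphi_0\rangle C^{\langle e,e'\rangle}\langle\psi_\infty\rangle$; (False) $\langle\bot\rangle C\langle\varphi\rangle$; (True) $\langle\varphi\rangle C\langle\top\rangle$; (Scale) from $\langle\varphi\rangle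 C\langle\psi\rangle$ infer $\langle u\odot\varphi\rangle C\langle u\odot\psi\rangle$; (Disj)/(Conj) combine two triples by $\lor$ resp. $\land$ on both sides; (Choice) from $\langle\phi(t)\rangle C\langle\phi'(t)\rangle$ for all $t\in T$ infer $\langle\bigoplus_{x\in T}\phi(x)\rangle C\langle\bigoplus_{x\in T}\phi'(x)\rangle$; (Exists) same with $\exists x{:}T$; (Consequence) if $\varphi'\subseteq\varphi$, $\langle\varphi\rangle C\langle\psi\rangle$, $\psi\subseteq\psi'$ then $\langle\varphi'\rangle C\langle\psi'\rangle$. -}

module Defs where

open import Level using (0ℓ)
open import Data.Nat using (ℕ; zero; suc)
open import Data.Bool using (Bool; true; false; if_then_else_; _∧_; _∨_; not)
open import Data.Maybe using (Maybe; just; nothing; _>>=_)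
open import Data.Product using (Σ; ∃; ∃-syntax; _×_; _,_; proj₁; proj₂)
open import Data.Unit using (⊤; tt)
open import Data.Empty using (⊥)
open import Data.List using (List; []; _∷_)
open import Data.List.Relation.Unary.All as All using (All)
open import Data.List.Relation.Unary.Unique.Propositional using (Unique)
open import Relation.Binary.PropositionalEquality
  using (_≡_; _≢_; refl; sym; trans; cong)
open import Relation.Nullary using (¬_)

record PartialSemiring : Set₁ where
  infixl 6 _⊹_
  infixl 7 _·_
  field
    U   : Set
    _⊹_ : U → U → Maybe U
    _·_ : U → U → U
    𝟘 𝟙 : U

    ⊹-comm     : ∀ x y → x ⊹ y ≡ y ⊹ x
    ⊹-assoc    : ∀ x y z → ((x ⊹ y) >>= λ w → w ⊹ z) ≡ ((y ⊹ z) >>= λ w → x ⊹ w)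
    ⊹-identity : ∀ x → x ⊹ 𝟘 ≡ just x
    ·-assoc     : ∀ x y z → (x · y) · z ≡ x · (y · z)
    ·-identityˡ : ∀ x → 𝟙 · x ≡ x
    ·-identityʳ : ∀ x → x · 𝟙 ≡ x
    distribˡ : ∀ x y z w → y ⊹ z ≡ just w → (x · y) ⊹ (x · z) ≡ just (x · w)
    distribʳ : ∀ x y z w → y ⊹ z ≡ just w → (y · x) ⊹ (z · x) ≡ just (w · x)
    zeroˡ : ∀ x → 𝟘 · x ≡ 𝟘
    zeroʳ : ∀ x → x · 𝟘 ≡ 𝟘

  _≤_ : U → U → Set
  u ≤ v = ∃[ w ] (u ⊹ w ≡ just v)

  IsUB : (U → Set) → U → Set
  IsUB D u = ∀ x → D x → x ≤ u

  IsSup : (U → Set) → U → Set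
  IsSup D u = IsUB D u × (∀ v → IsUB D v → u ≤ v)

  Directed : (U → Set) → Set
  Directed D = (∃[ x ] D x) × (∀ x y → D x → D y → ∃[ z ] (D z × x ≤ z × y ≤ z))

  field
    -- naturally ordered: ≤ is a partial order (reflexivity and
    -- transitivity follow from the monoid laws; antisymmetry is assumed)
    ≤-antisym : ∀ u v → u ≤ v → v ≤ u → u ≡ v
    dcpo   : ∀ D → Directed D → ∃[ d ] IsSup D d
    ⊹-cont : ∀ D d y → Directed D → IsSup D d →
             (∀ x → D x → ∃[ z ] (x ⊹ y ≡ just z)) →
             ∃[ s ] (d ⊹ y ≡ just s × IsSup (λ z → ∃[ x ] (D x × x ⊹ y ≡ just z)) s)
    ·-contˡ : ∀ D d y → Directed D → IsSup D d →
              IsSup (λ z → ∃[ x ] (D x × z ≡ x · y)) (d · y)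
    ·-contʳ : ∀ D d y → Directed D → IsSup D d →
              IsSup (λ z → ∃[ x ] (D x × z ≡ y · x)) (y · d)
    top : ∃[ t ] (∀ u → u ≤ t)

module Weighting (S : PartialSemiring) (St : Set) where
  open PartialSemiring S public

  finSum : {I : Set} → (I → U) → List I → Maybe U
  finSum f []       = just 𝟘
  finSum f (i ∷ is) = finSum f is >>= λ v → f i ⊹ v

  -- finite partial sums of the family f restricted to {i | P i}
  -- (finite subsets are represented by duplicate-free lists)
  PartialSums : {I : Set} → (I → Set) → (I → U) → U → Set
  PartialSums P f v = ∃[ is ] (Unique is × All P is × finSum f is ≡ just v)

  IsSumOver : {I : Set} → (I → Set) → (I → U) → U → Set
  IsSumOver P f s =
    (∀ is → Unique is → All P is → ∃[ v ] (finSum f is ≡ just v)) ×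
    IsSup (PartialSums P f) s

  Supp : (St → U) → St → Set
  Supp m σ = m σ ≢ 𝟘

  Countable : (St → Set) → Set
  Countable P = Σ (ℕ → Maybe St) λ e →
    (∀ n σ → e n ≡ just σ → P σ) × (∀ σ → P σ → ∃[ n ] (e n ≡ just σ))

  IsW : (St → U) → Set
  IsW m = Countable (Supp m) × ∃[ s ] IsSumOver (Supp m) m s

  IsEta : St → (St → U) → Set
  IsEta σ m = m σ ≡ 𝟙 × (∀ τ → τ ≢ σ → m τ ≡ 𝟘)

  IsBind : (St → St → U) → (St → U) → (St → U) → Set
  IsBind f m r = IsW r × (∀ τ → IsSumOver (Supp m) (λ σ → m σ · f σ τ) (r τ))

  IsFamSum : {T : Set} → (T → St → U) → (St → U) → Set
  IsFamSum ms r = IsW r × (∀ τ → IsSumOver (λ _ → ⊤) (λ t → ms t τ) (r τ))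

  IsPlus : (St → U) → (St → U) → (St → U) → Set
  IsPlus m₁ m₂ r = IsW r × (∀ τ → m₁ τ ⊹ m₂ τ ≡ just (r τ))

  _≗_ : (St → U) → (St → U) → Set
  m ≗ m' = ∀ σ → m σ ≡ m' σ

  finSum-ext : {I : Set} (f g : I → U) → (∀ i → f i ≡ g i) → ∀ is → finSum f is ≡ finSum g is
  finSum-ext f g eq []       = refl
  finSum-ext f g eq (i ∷ is) rewrite finSum-ext f g eq is | eq i = refl

  IsSumOver-ext : {I : Set} (P Q : I → Set) (f g : I → U) (s : U) →
                  (∀ i → P i → Q i) → (∀ i → Q i → P i) → (∀ i → f i ≡ g i) →
                  IsSumOver P f s → IsSumOver Q g s
  IsSumOver-ext P Q f g s pq qp fg (def , ub , lub) =
    (λ is u a → let (v , e) = def is u (All.map (qp _) a)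
                in v , trans (sym (finSum-ext f g fg is)) e) ,
    (λ x (is , u , a , e) → ub x (is , u , All.map (qp _) a , trans (finSum-ext f g fg is) e)) ,
    (λ v ubv → lub v (λ x (is , u , a , e) →
       ubv x (is , u , All.map (pq _) a , trans (sym (finSum-ext f g fg is)) e)))

  IsW-ext : ∀ m m' → m ≗ m' → IsW m → IsW m'
  IsW-ext m m' eq ((e , sound , compl) , s , sm) =
    (e , (λ n σ en z → sound n σ en (trans (eq σ) z)) ,
         (λ σ neq → compl σ (λ z → neq (trans (sym (eq σ)) z)))) ,
    s , IsSumOver-ext (Supp m) (Supp m') m m' s
          (λ σ neq z → neq (trans (eq σ) z))
          (λ σ neq z → neq (trans (sym (eq σ)) z)) eq sm

  record Assertion : Set₁ where
    field
      _∋_ : (St → U) → Set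
      inW : ∀ m → _∋_ m → IsW m
      ext : ∀ m m' → m ≗ m' → _∋_ m → _∋_ m'
  open Assertion public

  ⊤ᴬ : Assertion
  ⊤ᴬ = record { _∋_ = IsW ; inW = λ _ w → w ; ext = IsW-ext }

  ⊥ᴬ : Assertion
  ⊥ᴬ = record { _∋_ = λ _ → ⊥ ; inW = λ _ () ; ext = λ _ _ _ () }

  _∧ᴬ_ : Assertion → Assertion → Assertion
  φ ∧ᴬ ψ = record
    { _∋_ = λ m → (φ ∋ m) × (ψ ∋ m)
    ; inW = λ m p → inW φ m (proj₁ p)
    ; ext = λ m m' eq p → ext φ m m' eq (proj₁ p) , ext ψ m m' eq (proj₂ p) }

  data _⊎'_ (A B : Set) : Set where
    inl : A → A ⊎' B
    inr : B → A ⊎' B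

  _∨ᴬ_ : Assertion → Assertion → Assertion
  φ ∨ᴬ ψ = record
    { _∋_ = λ m → (φ ∋ m) ⊎' (ψ ∋ m)
    ; inW = λ { m (inl p) → inW φ m p ; m (inr p) → inW ψ m p }
    ; ext = λ { m m' eq (inl p) → inl (ext φ m m' eq p) ; m m' eq (inr p) → inr (ext ψ m m' eq p) } }

  ∃ᴬ : (T : Set) → (T → Assertion) → Assertion
  ∃ᴬ T φ = record
    { _∋_ = λ m → ∃[ t ] (φ t ∋ m)
    ; inW = λ m (t , p) → inW (φ t) m p
    ; ext = λ m m' eq (t , p) → t , ext (φ t) m m' eq p }

  ⨁ᴬ : (T : Set) → (T → Assertion) → Assertion
  ⨁ᴬ T φ = record
    { _∋_ = λ r → ∃[ ms ] ((∀ t → φ t ∋ ms t) × IsFamSum ms r)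
    ; inW = λ r (ms , _ , w , _) → w
    ; ext = λ r r' eq (ms , p , w , s) →
        ms , p , IsW-ext r r' eq w ,
        (λ τ → subst' (eq τ) (s τ)) }
    where
      subst' : ∀ {T : Set} {f : T → U} {a b} → a ≡ b → IsSumOver (λ _ → ⊤) f a → IsSumOver (λ _ → ⊤) f b
      subst' refl x = x

  _⊕ᴬ_ : Assertion → Assertion → Assertion
  φ ⊕ᴬ ψ = record
    { _∋_ = λ r → ∃[ m₁ ] ∃[ m₂ ] ((φ ∋ m₁) × (ψ ∋ m₂) × IsPlus m₁ m₂ r)
    ; inW = λ r (_ , _ , _ , _ , w , _) → w
    ; ext = λ r r' eq (m₁ , m₂ , p , q , w , s) →
        m₁ , m₂ , p , q , IsW-ext r r' eq w , (λ τ → trans (s τ) (cong just (eq τ))) }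

  _⊙ᴬ_ : U → Assertion → Assertion
  u ⊙ᴬ φ = record
    { _∋_ = λ r → IsW r × ∃[ m ] ((φ ∋ m) × (∀ σ → r σ ≡ u · m σ))
    ; inW = λ r p → proj₁ p
    ; ext = λ r r' eq (w , m , p , e) →
        IsW-ext r r' eq w , m , p , (λ σ → trans (sym (eq σ)) (e σ)) }

  _ᴬ⊙_ : Assertion → U → Assertion
  φ ᴬ⊙ u = record
    { _∋_ = λ r → IsW r × ∃[ m ] ((φ ∋ m) × (∀ σ → r σ ≡ m σ · u))
    ; inW = λ r p → proj₁ p
    ; ext = λ r r' eq (w , m , p , e) →
        IsW-ext r r' eq w , m , p , (λ σ → trans (sym (eq σ)) (e σ)) }

  _⊆ᴬ_ : Assertion → Assertion → Set
  φ ⊆ᴬ ψ = ∀ m → φ ∋ m → ψ ∋ m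

module Language (S : PartialSemiring) (St : Set) (Act : Set)
                (⟦_⟧ₐ : Act → St → St → PartialSemiring.U S) where
  open Weighting S St public

  data Test : Set where
    prim  : (St → Bool) → Test
    ttrue tfalse : Test
    _or_ _and_ : Test → Test → Test
    neg : Test → Test

  evalT : Test → St → Bool
  evalT (prim t)  σ = t σ
  evalT ttrue     σ = true
  evalT tfalse    σ = false
  evalT (b or c)  σ = evalT b σ ∨ evalT c σ
  evalT (b and c) σ = evalT b σ ∧ evalT c σ
  evalT (neg b)   σ = not (evalT b σ)

  data Expr : Set where
    test  : Test → Expr
    const : U → Expr

  ⟦_⟧ₑ : Expr → St → U
  ⟦ test b ⟧ₑ σ  = if evalT b σ then 𝟙 else 𝟘
  ⟦ const u ⟧ₑ σ = u

  data Prog : Set where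
    skip   : Prog
    _⨾_    : Prog → Prog → Prog
    _⊕_    : Prog → Prog → Prog
    assume : Expr → Prog
    iter   : Prog → Expr → Expr → Prog
    act    : Act → Prog

  IsKernel : (St → St → U) → Set
  IsKernel f = ∀ σ → IsW (f σ)

  IsΦ : (St → St → U) → Expr → Expr → (St → St → U) → (St → St → U) → Set
  IsΦ g e e' h h' = ∀ σ → ∃[ b ] ∃[ η ] (IsBind h (g σ) b × IsEta σ η ×
                      (∀ τ → (⟦ e ⟧ₑ σ · b τ) ⊹ (⟦ e' ⟧ₑ σ · η τ) ≡ just (h' σ τ)))

  IsLFP : (St → St → U) → Expr → Expr → (St → St → U) → Set
  IsLFP g e e' h = IsΦ g e e' h h ×
    (∀ h' → IsKernel h' → IsΦ g e e' h' h' → ∀ σ τ → h σ τ ≤ h' σ τ)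

  -- ⟦C⟧ = f  (as a relation; f is a total map St → 𝒲(St))
  SemR : Prog → (St → St → U) → Set
  SemR skip       f = ∀ σ → IsEta σ (f σ)
  SemR (C₁ ⨾ C₂)  f = ∃[ f₁ ] ∃[ f₂ ] (IsKernel f₁ × SemR C₁ f₁ × IsKernel f₂ × SemR C₂ f₂ ×
                       (∀ σ → IsBind f₂ (f₁ σ) (f σ)))
  SemR (C₁ ⊕ C₂)  f = ∃[ f₁ ] ∃[ f₂ ] (IsKernel f₁ × SemR C₁ f₁ × IsKernel f₂ × SemR C₂ f₂ ×
                       (∀ σ → IsPlus (f₁ σ) (f₂ σ) (f σ)))
  SemR (assume e) f = ∀ σ → ∃[ η ] (IsEta σ η × (∀ τ → f σ τ ≡ ⟦ e ⟧ₑ σ · η τ))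
  SemR (iter C e e') f = ∃[ g ] (IsKernel g × SemR C g × IsLFP g e e' f)
  SemR (act a)    f = ∀ σ τ → f σ τ ≡ ⟦ a ⟧ₐ σ τ

  Sem : Prog → (St → St → U) → Set
  Sem C f = IsKernel f × SemR C f

  WellFormed : Prog → Set
  WellFormed C = ∃[ f ] Sem C f

  Valid : Assertion → Prog → Assertion → Set
  Valid φ C ψ = ∀ f → Sem C f → ∀ m → φ ∋ m → ∃[ r ] (IsBind f m r × ψ ∋ r)

  _⊨_≐_ : Assertion → Expr → U → Set
  φ ⊨ e ≐ u = ∀ m → φ ∋ m → ∀ σ → Supp m σ → ⟦ e ⟧ₑ σ ≡ u

  Converges : (ℕ → Assertion) → Assertion → Set
  Converges ψ ψ∞ = ∀ ms → (∀ n → ψ n ∋ ms n) → ∃[ r ] (IsFamSum ms r × ψ∞ ∋ r)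

  Axioms : Set₂
  Axioms = Assertion → Prog → Assertion → Set₁

  data _⊢⟨_⟩_⟨_⟩ (Γ : Axioms) : Assertion → Prog → Assertion → Set₁ where
    ax     : ∀ {φ C ψ} → Γ φ C ψ → Γ ⊢⟨ φ ⟩ C ⟨ ψ ⟩
    skipR  : ∀ {φ} → Γ ⊢⟨ φ ⟩ skip ⟨ φ ⟩
    seqR   : ∀ {φ ϑ ψ C₁ C₂} → Γ ⊢⟨ φ ⟩ C₁ ⟨ ϑ ⟩ → Γ ⊢⟨ ϑ ⟩ C₂ ⟨ ψ ⟩ →
             Γ ⊢⟨ φ ⟩ C₁ ⨾ C₂ ⟨ ψ ⟩
    plusR  : ∀ {φ ψ₁ ψ₂ C₁ C₂} → Γ ⊢⟨ φ ⟩ C₁ ⟨ ψ₁ ⟩ → Γ ⊢⟨ φ ⟩ C₂ ⟨ ψ₂ ⟩ →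
             Γ ⊢⟨ φ ⟩ C₁ ⊕ C₂ ⟨ ψ₁ ⊕ᴬ ψ₂ ⟩
    assumeR : ∀ {φ e u} → φ ⊨ e ≐ u → Γ ⊢⟨ φ ⟩ assume e ⟨ φ ᴬ⊙ u ⟩
    iterR  : ∀ {C e e'} (φ ψ : ℕ → Assertion) (ψ∞ : Assertion) →
             Converges ψ ψ∞ →
             (∀ n → Γ ⊢⟨ φ n ⟩ assume e ⨾ C ⟨ φ (suc n) ⟩) →
             (∀ n → Γ ⊢⟨ φ n ⟩ assume e' ⟨ ψ n ⟩) →
             Γ ⊢⟨ φ zero ⟩ iter C e e' ⟨ ψ∞ ⟩
    falseR : ∀ {C φ} → Γ ⊢⟨ ⊥ᴬ ⟩ C ⟨ φ ⟩
    trueR  : ∀ {C φ} → Γ ⊢⟨ φ ⟩ C ⟨ ⊤ᴬ ⟩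
    scaleR : ∀ {φ C ψ} u → Γ ⊢⟨ φ ⟩ C ⟨ ψ ⟩ → Γ ⊢⟨ u ⊙ᴬ φ ⟩ C ⟨ u ⊙ᴬ ψ ⟩
    disjR  : ∀ {φ₁ φ₂ C ψ₁ ψ₂} → Γ ⊢⟨ φ₁ ⟩ C ⟨ ψ₁ ⟩ → Γ ⊢⟨ φ₂ ⟩ C ⟨ ψ₂ ⟩ →
             Γ ⊢⟨ φ₁ ∨ᴬ φ₂ ⟩ C ⟨ ψ₁ ∨ᴬ ψ₂ ⟩
    conjR  : ∀ {φ₁ φ₂ C ψ₁ ψ₂} → Γ ⊢⟨ φ₁ ⟩ C ⟨ ψ₁ ⟩ → Γ ⊢⟨ φ₂ ⟩ C ⟨ ψ₂ ⟩ →
             Γ ⊢⟨ φ₁ ∧ᴬ φ₂ ⟩ C ⟨ ψ₁ ∧ᴬ ψ₂ ⟩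
    choiceR : ∀ {C} (T : Set) (φ φ' : T → Assertion) →
              (∀ t → Γ ⊢⟨ φ t ⟩ C ⟨ φ' t ⟩) → Γ ⊢⟨ ⨁ᴬ T φ ⟩ C ⟨ ⨁ᴬ T φ' ⟩
    existsR : ∀ {C} (T : Set) (φ φ' : T → Assertion) →
              (∀ t → Γ ⊢⟨ φ t ⟩ C ⟨ φ' t ⟩) → Γ ⊢⟨ ∃ᴬ T φ ⟩ C ⟨ ∃ᴬ T φ' ⟩
    consR  : ∀ {φ φ' C ψ ψ'} → φ' ⊆ᴬ φ → Γ ⊢⟨ φ ⟩ C ⟨ ψ ⟩ → ψ ⊆ᴬ ψ' →
             Γ ⊢⟨ φ' ⟩ C ⟨ ψ' ⟩

  data Ω : Axioms where
    valid-act : ∀ {φ a ψ} → Valid φ (act a) ψ → Ω φ (act a) ψ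

-- Every weighting m is the sum ∑σ m σ · η σ of scaled point masses, so the Exists, Choice and
-- Scale rules reduce any valid triple for C to the triples ⟨{η σ}⟩ C ⟨{⟦C⟧ σ}⟩, which are derived
-- by induction on C.  For a loop the semantics ⟦C^⟨e,e'⟩⟧ σ is the sum over n of the n-th
-- unrolling (assume e ⨾ C)ⁿ ⨾ assume e' applied to σ: the partial sums of the unrollings lie below
-- the least fixed point, and by Scott continuity and Fubini their sum is itself a fixed point.
-- The Iter rule then applies with the unrollings as the postconditions ψₙ.

module Submission where

open import Defs
open import Level using (0ℓ)
open import Axiom.ExcludedMiddle using (ExcludedMiddle)
open import Function using (_∘_)
open import Data.Unit using (⊤; tt)
open import Data.Product using (∃; ∃-syntax; _×_; _,_; proj₁; proj₂)
open import Data.Maybe using (Maybe; just; nothing; _>>=_)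
open import Data.Maybe.Properties using (just-injective)
open import Data.Nat using (ℕ; zero; suc; _+_; _⊔_)
open import Data.Nat.Properties using (m≤m⊔n; m≤n⊔m; <-≤-trans; +-suc; +-identityʳ; suc-injective)
open import Data.List using (List; []; _∷_; _++_; map; filter; deduplicate; upTo)
open import Data.List.Properties using (map-upTo)
open import Data.List.Relation.Unary.All as All using (All; []; _∷_)
open import Data.List.Relation.Unary.All.Properties using (all-filter)
open import Data.List.Relation.Unary.Any using (here; there)
open import Data.List.Relation.Unary.Unique.Propositional using (Unique; []; _∷_)
open import Data.List.Relation.Unary.Unique.Propositional.Properties using (upTo⁺; filter⁺)
open import Data.List.Relation.Unary.Unique.DecPropositional.Properties using (deduplicate-!)
open import Data.List.Membership.Propositional.Properties
  using (∈-∃++; ∈-++⁺ˡ; ∈-++⁺ʳ; ∈-deduplicate⁺; ∈-upTo⁺; ∈-upTo⁻)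
open import Data.List.Relation.Binary.Subset.Propositional using (_⊆_)
open import Data.List.Relation.Binary.Permutation.Propositional using (_↭_; refl; prep; swap; trans; ↭⇒↭ₛ)
open import Data.List.Relation.Binary.Permutation.Propositional.Properties using (∈-resp-↭; shift)
import Data.List.Relation.Binary.Permutation.Setoid.Properties as Permutationₛ
open import Relation.Nullary using (¬_; yes; no; contradiction)
open import Relation.Unary using (Decidable)
open import Relation.Binary.Definitions using (DecidableEquality)
open import Relation.Binary.PropositionalEquality as ≡
  using (_≡_; _≢_; refl; sym; cong; cong₂; subst; subst₂)
open import Relation.Binary.PropositionalEquality.Properties using (setoid)
open ≡.≡-Reasoning

module _ {A B : Set} where

  >>=-just⁻ : ∀ (m : Maybe A) {k : A → Maybe B} {b} → (m >>= k) ≡ just b →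
              ∃[ a ] (m ≡ just a × k a ≡ just b)
  >>=-just⁻ (just a) eq = a , refl , eq

module PartialMonoid (S : PartialSemiring) where
  open PartialSemiring S

  infix 4 _⊹_⇓_

  _⊹_⇓_ : U → U → U → Set
  x ⊹ y ⇓ z = x ⊹ y ≡ just z

  private variable a b c d x y z w x' y' z' : U

  ⇓-functional : x ⊹ y ⇓ z → x ⊹ y ⇓ z' → z ≡ z'
  ⇓-functional p q = just-injective (≡.trans (sym p) q)

  ⇓-comm : x ⊹ y ⇓ z → y ⊹ x ⇓ z
  ⇓-comm {x} {y} p = ≡.trans (⊹-comm y x) p

  ⇓-identityʳ : ∀ x → x ⊹ 𝟘 ⇓ x
  ⇓-identityʳ = ⊹-identity

  ⇓-identityˡ : ∀ x → 𝟘 ⊹ x ⇓ x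
  ⇓-identityˡ x = ⇓-comm (⊹-identity x)

  ⇓-assocʳ : x ⊹ y ⇓ a → a ⊹ z ⇓ b → ∃[ c ] (y ⊹ z ⇓ c × x ⊹ c ⇓ b)
  ⇓-assocʳ {x} {y} {a} {z} {b} x+y a+z = >>=-just⁻ (y ⊹ z) (begin
    (y ⊹ z >>= x ⊹_)  ≡⟨ sym (⊹-assoc x y z) ⟩
    (x ⊹ y >>= _⊹ z)  ≡⟨ cong (_>>= _⊹ z) x+y ⟩
    a ⊹ z             ≡⟨ a+z ⟩
    just b            ∎)

  ⇓-assocˡ : y ⊹ z ⇓ c → x ⊹ c ⇓ b → ∃[ a ] (x ⊹ y ⇓ a × a ⊹ z ⇓ b)
  ⇓-assocˡ {y} {z} {c} {x} {b} y+z x+c = >>=-just⁻ (x ⊹ y) (begin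
    (x ⊹ y >>= _⊹ z)  ≡⟨ ⊹-assoc x y z ⟩
    (y ⊹ z >>= x ⊹_)  ≡⟨ cong (_>>= x ⊹_) y+z ⟩
    x ⊹ c             ≡⟨ x+c ⟩
    just b            ∎)

  ⇓-swapˡ : y ⊹ w ⇓ c → x ⊹ c ⇓ b → ∃[ d ] (x ⊹ w ⇓ d × y ⊹ d ⇓ b)
  ⇓-swapˡ y+w x+c = let _ , x+y , a+w = ⇓-assocˡ y+w x+c in ⇓-assocʳ (⇓-comm x+y) a+w

  ⇓-interchange : a ⊹ b ⇓ x → c ⊹ d ⇓ y → x ⊹ y ⇓ z →
                  ∃[ x' ] ∃[ y' ] (a ⊹ c ⇓ x' × b ⊹ d ⇓ y' × x' ⊹ y' ⇓ z)
  ⇓-interchange a+b c+d x+y =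
    let w , b+y , a+w = ⇓-assocʳ a+b x+y
        y' , b+d , c+y' = ⇓-swapˡ c+d b+y
        x' , a+c , x'+y' = ⇓-assocˡ c+y' a+w
    in x' , y' , a+c , b+d , x'+y'

  ⇓-identityˡ-≡ : x ≡ 𝟘 → x ⊹ y ⇓ y
  ⇓-identityˡ-≡ refl = ⇓-identityˡ _

  ≤-refl : ∀ x → x ≤ x
  ≤-refl x = 𝟘 , ⇓-identityʳ x

  ≤-reflexive : x ≡ y → x ≤ y
  ≤-reflexive {x} refl = ≤-refl x

  ≤-trans : x ≤ y → y ≤ z → x ≤ z
  ≤-trans (_ , x+u) (_ , y+v) = let w , _ , x+w = ⇓-assocʳ x+u y+v in w , x+w

  𝟘-least : ∀ x → 𝟘 ≤ x
  𝟘-least x = x , ⇓-identityˡ x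

  ≤𝟘⇒≡𝟘 : x ≤ 𝟘 → x ≡ 𝟘
  ≤𝟘⇒≡𝟘 {x} x≤𝟘 = ≤-antisym x 𝟘 x≤𝟘 (𝟘-least x)

  ⇓⇒≤ʳ : x ⊹ y ⇓ z → y ≤ z
  ⇓⇒≤ʳ x+y = _ , ⇓-comm x+y

  ⊹-mono-≤ : x ≤ x' → y ≤ y' → x' ⊹ y' ⇓ z' → ∃[ z ] (x ⊹ y ⇓ z × z ≤ z')
  ⊹-mono-≤ (_ , x+u) (_ , y+v) x'+y' =
    let _ , u+y' , x+c = ⇓-assocʳ x+u x'+y'
        _ , _ , y+d = ⇓-swapˡ y+v u+y'
        z , x+y , z+d = ⇓-assocˡ y+d x+c
    in z , x+y , _ , z+d

  IsSup-cong : {D D' : U → Set} → (∀ x → D x → D' x) → (∀ x → D' x → D x) →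
               IsSup D d → IsSup D' d
  IsSup-cong D⊆D' D'⊆D (ub , lub) = (λ x → ub x ∘ D'⊆D x) , (λ v ubv → lub v (λ x → ubv x ∘ D⊆D' x))

  sup-⊹-≤ : {D : U → Set} → Directed D → IsSup D d →
            (∀ x → D x → ∃[ z ] (x ⊹ y ⇓ z × z ≤ b)) → ∃[ s ] (d ⊹ y ⇓ s × s ≤ b)
  sup-⊹-≤ {d} {y} {b} {D} dir sup bounded =
    let s , d+y , _ , lub = ⊹-cont D d y dir sup (λ x Dx → let z , x+y , _ = bounded x Dx in z , x+y)
    in s , d+y , lub b λ z (x , Dx , x+y) →
         let _ , x+y' , z'≤b = bounded x Dx in subst (_≤ b) (⇓-functional x+y' x+y) z'≤b

  ·-monoʳ-≤ : ∀ u → x ≤ y → (u · x) ≤ (u · y)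
  ·-monoʳ-≤ {x} {y} u (w , x+w) = u · w , distribˡ u x w y x+w

Unique-resp-↭ : {A : Set} {xs ys : List A} → xs ↭ ys → Unique xs → Unique ys
Unique-resp-↭ p = Permutationₛ.Unique-resp-↭ (setoid _) (↭⇒↭ₛ p)

module FiniteSums (S : PartialSemiring) where
  open PartialSemiring S
  open PartialMonoid S

  private variable
    I J : Set
    f g h : I → U
    L L' : List I
    a b c s t : U

  -- The graph of finSum from Defs, as an inductive relation that proofs can match on.
  data FinSum {I : Set} (f : I → U) : List I → U → Set where
    []  : FinSum f [] 𝟘
    _∷_ : ∀ {i L v s} → f i ⊹ v ⇓ s → FinSum f L v → FinSum f (i ∷ L) s

  FinSum-functional : FinSum f L s → FinSum f L t → s ≡ t
  FinSum-functional [] [] = refl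
  FinSum-functional (p ∷ P) (q ∷ Q) rewrite FinSum-functional P Q = ⇓-functional p q

  FinSum-[]⁻ : FinSum f [] s → s ≡ 𝟘
  FinSum-[]⁻ [] = refl

  FinSum-∷⁻ : ∀ {i} → FinSum f (i ∷ L) s → ∃[ v ] (f i ⊹ v ⇓ s × FinSum f L v)
  FinSum-∷⁻ (p ∷ P) = _ , p , P

  FinSum-resp-↭ : L ↭ L' → FinSum f L s → FinSum f L' s
  FinSum-resp-↭ refl P = P
  FinSum-resp-↭ (prep _ π) (p ∷ P) = p ∷ FinSum-resp-↭ π P
  FinSum-resp-↭ (swap _ _ π) (p ∷ q ∷ P) =
    let _ , r , q' = ⇓-swapˡ q p in q' ∷ r ∷ FinSum-resp-↭ π P
  FinSum-resp-↭ (trans π π') P = FinSum-resp-↭ π' (FinSum-resp-↭ π P)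

  FinSum-⊆ : Unique L → L ⊆ L' → Unique L' → FinSum f L' t → ∃[ s ] (FinSum f L s × s ≤ t)
  FinSum-⊆ [] _ _ _ = 𝟘 , [] , 𝟘-least _
  FinSum-⊆ {L = i ∷ L} (i∉L ∷ uL) L⊆L' uL' P'
    with ys , zs , refl ← ∈-∃++ (L⊆L' (here refl))
    with p ∷ P ← FinSum-resp-↭ (shift i ys zs) P'
       | _ ∷ uR ← Unique-resp-↭ (shift i ys zs) uL'
    = let s' , Q , s'≤r = FinSum-⊆ uL L⊆R uR P
          s , q , s≤t = ⊹-mono-≤ (≤-refl _) s'≤r p
      in s , q ∷ Q , s≤t
    where
      L⊆R : L ⊆ ys ++ zs
      L⊆R z∈L with ∈-resp-↭ (shift i ys zs) (L⊆L' (there z∈L))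
      ... | here z≡i = contradiction (sym z≡i) (All.lookup i∉L z∈L)
      ... | there z∈R = z∈R

  FinSum-⊆-≤ : Unique L → L ⊆ L' → Unique L' → FinSum f L s → FinSum f L' t → s ≤ t
  FinSum-⊆-≤ u L⊆L' u' P P' = let _ , Q , ≤t = FinSum-⊆ u L⊆L' u' P' in
    subst (_≤ _) (FinSum-functional Q P) ≤t

  FinSum-mono-≤ : (∀ i → f i ≤ g i) → FinSum g L t → ∃[ s ] (FinSum f L s × s ≤ t)
  FinSum-mono-≤ f≤g [] = 𝟘 , [] , ≤-refl 𝟘
  FinSum-mono-≤ {L = i ∷ _} f≤g (p ∷ P) =
    let v , Q , v≤ = FinSum-mono-≤ f≤g P
        s , q , s≤ = ⊹-mono-≤ (f≤g i) v≤ p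
    in s , q ∷ Q , s≤

  FinSum-scaleˡ : ∀ u → FinSum f L s → FinSum (λ i → u · f i) L (u · s)
  FinSum-scaleˡ u [] = subst (FinSum _ []) (sym (zeroʳ u)) []
  FinSum-scaleˡ {f = f} {L = i ∷ _} u (p ∷ P) = distribˡ u (f i) _ _ p ∷ FinSum-scaleˡ u P

  FinSum-scaleʳ : ∀ u → FinSum f L s → FinSum (λ i → f i · u) L (s · u)
  FinSum-scaleʳ u [] = subst (FinSum _ []) (sym (zeroˡ u)) []
  FinSum-scaleʳ {f = f} {L = i ∷ _} u (p ∷ P) = distribʳ u (f i) _ _ p ∷ FinSum-scaleʳ u P

  FinSum-split : (∀ i → f i ⊹ g i ⇓ h i) → FinSum h L c →
                 ∃[ a ] ∃[ b ] (FinSum f L a × FinSum g L b × a ⊹ b ⇓ c)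
  FinSum-split f+g [] = 𝟘 , 𝟘 , [] , [] , ⇓-identityʳ 𝟘
  FinSum-split {L = i ∷ _} f+g (p ∷ P) =
    let _ , _ , Pf , Pg , a+b = FinSum-split f+g P
        a , b , q , r , a'+b' = ⇓-interchange (f+g i) a+b p
    in a , b , q ∷ Pf , r ∷ Pg , a'+b'

  FinSum-zero : All (λ i → f i ≡ 𝟘) L → FinSum f L 𝟘
  FinSum-zero [] = []
  FinSum-zero (fi≡𝟘 ∷ z) = ⇓-identityˡ-≡ fi≡𝟘 ∷ FinSum-zero z

  FinSum-cong : (∀ i → f i ≡ g i) → FinSum f L s → FinSum g L s
  FinSum-cong f≗g [] = []
  FinSum-cong {L = i ∷ _} f≗g (p ∷ P) = subst (_⊹ _ ⇓ _) (f≗g i) p ∷ FinSum-cong f≗g P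

  module _ {P : I → Set} (P? : Decidable P) (f-vanishes : ∀ i → ¬ P i → f i ≡ 𝟘) where

    FinSum-filter⁺ : FinSum f L s → FinSum f (filter P? L) s
    FinSum-filter⁺ [] = []
    FinSum-filter⁺ {L = i ∷ L} (p ∷ Q) with P? i
    ... | yes _  = p ∷ FinSum-filter⁺ Q
    ... | no ¬Pi = subst (FinSum f _) (⇓-functional (⇓-identityˡ-≡ (f-vanishes i ¬Pi)) p) (FinSum-filter⁺ Q)

    FinSum-filter⁻ : FinSum f (filter P? L) s → FinSum f L s
    FinSum-filter⁻ {L = []} [] = []
    FinSum-filter⁻ {L = i ∷ L} Q with P? i | Q
    ... | yes _  | p ∷ Q' = p ∷ FinSum-filter⁻ Q'
    ... | no ¬Pi | Q'     = ⇓-identityˡ-≡ (f-vanishes i ¬Pi) ∷ FinSum-filter⁻ Q'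

  FinSum-map⁺ : ∀ (e : J → I) → FinSum (f ∘ e) L s → FinSum f (map e L) s
  FinSum-map⁺ e [] = []
  FinSum-map⁺ e (p ∷ P) = p ∷ FinSum-map⁺ e P

  FinSum-map⁻ : ∀ (e : J → I) L → FinSum f (map e L) s → FinSum (f ∘ e) L s
  FinSum-map⁻ e [] [] = []
  FinSum-map⁻ e (_ ∷ L) (p ∷ P) = p ∷ FinSum-map⁻ e L P

module Sums (em : ExcludedMiddle 0ℓ) (S : PartialSemiring) where
  open PartialSemiring S
  open PartialMonoid S
  open FiniteSums S

  private variable
    I J : Set
    f g h : I → U
    L : List I
    a b c s t v : U

  _≟_ : DecidableEquality I
  _ ≟ _ = em

  ⊆-union : (L₁ L₂ : List I) → ∃[ L ] (Unique L × L₁ ⊆ L × L₂ ⊆ L)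
  ⊆-union L₁ L₂ =
    deduplicate _≟_ (L₁ ++ L₂) , deduplicate-! _≟_ (L₁ ++ L₂) ,
    ∈-deduplicate⁺ _≟_ ∘ ∈-++⁺ˡ , ∈-deduplicate⁺ _≟_ ∘ ∈-++⁺ʳ L₁

  FinitelySummable : (I → U) → Set
  FinitelySummable f = ∀ L → Unique L → ∃ (FinSum f L)

  PartialSum : (I → U) → U → Set
  PartialSum f v = ∃[ L ] (Unique L × FinSum f L v)

  -- IsSumOver (λ _ → ⊤) from Defs, phrased with FinSum and without its trivial All-component.
  HasSum : (I → U) → U → Set
  HasSum f s = FinitelySummable f × IsSup (PartialSum f) s

  PartialSum-directed : FinitelySummable f → Directed (PartialSum f)
  PartialSum-directed fs =
    (𝟘 , [] , [] , []) , λ x y (L₁ , u₁ , P₁) (L₂ , u₂ , P₂) →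
      let L , u , L₁⊆L , L₂⊆L = ⊆-union L₁ L₂
          z , P = fs L u
      in z , (L , u , P) , FinSum-⊆-≤ u₁ L₁⊆L u P₁ P , FinSum-⊆-≤ u₂ L₂⊆L u P₂ P

  HasSum-exists : FinitelySummable f → ∃ (HasSum f)
  HasSum-exists fs = let s , sup = dcpo _ (PartialSum-directed fs) in s , fs , sup

  HasSum-unique : HasSum f s → HasSum f t → s ≡ t
  HasSum-unique (_ , ub , lub) (_ , ub' , lub') = ≤-antisym _ _ (lub _ ub') (lub' _ ub)

  FinSum≤HasSum : HasSum f s → Unique L → FinSum f L v → v ≤ s
  FinSum≤HasSum (_ , ub , _) u P = ub _ (_ , u , P)

  FinitelySummable-mono : (∀ i → f i ≤ g i) → FinitelySummable g → FinitelySummable f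
  FinitelySummable-mono f≤g fsg L u = let _ , P = fsg L u ; s , Q , _ = FinSum-mono-≤ f≤g P in s , Q

  HasSum-mono : (∀ i → f i ≤ g i) → HasSum f s → HasSum g t → s ≤ t
  HasSum-mono f≤g (_ , _ , lub) Σg@(fsg , _) = lub _ λ v (L , u , P) →
    let w , Q = fsg L u
        v' , P' , v'≤w = FinSum-mono-≤ f≤g Q
    in subst (_≤ _) (FinSum-functional P' P) (≤-trans v'≤w (FinSum≤HasSum Σg u Q))

  HasSum-cong : (∀ i → f i ≡ g i) → HasSum f s → HasSum g s
  HasSum-cong f≗g (fs , sup) =
    (λ L u → let v , P = fs L u in v , FinSum-cong f≗g P) ,
    IsSup-cong (λ v (L , u , P) → L , u , FinSum-cong f≗g P)
               (λ v (L , u , P) → L , u , FinSum-cong (sym ∘ f≗g) P) sup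

  HasSum-scaleˡ : ∀ u → HasSum f s → HasSum (λ i → u · f i) (u · s)
  HasSum-scaleˡ {f = f} {s} u (fs , sup) =
    (λ L uL → let v , P = fs L uL in u · v , FinSum-scaleˡ u P) ,
    IsSup-cong (λ z (v , (L , uL , P) , z≡uv) → L , uL , subst (FinSum _ L) (sym z≡uv) (FinSum-scaleˡ u P))
               (λ z (L , uL , Q) → let v , P = fs L uL in
                  v , (L , uL , P) , FinSum-functional Q (FinSum-scaleˡ u P))
               (·-contʳ (PartialSum f) s u (PartialSum-directed fs) sup)

  HasSum-scaleʳ : ∀ u → HasSum f s → HasSum (λ i → f i · u) (s · u)
  HasSum-scaleʳ {f = f} {s} u (fs , sup) =
    (λ L uL → let v , P = fs L uL in v · u , FinSum-scaleʳ u P) ,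
    IsSup-cong (λ z (v , (L , uL , P) , z≡vu) → L , uL , subst (FinSum _ L) (sym z≡vu) (FinSum-scaleʳ u P))
               (λ z (L , uL , Q) → let v , P = fs L uL in
                  v , (L , uL , P) , FinSum-functional Q (FinSum-scaleʳ u P))
               (·-contˡ (PartialSum f) s u (PartialSum-directed fs) sup)

  FinSum-single : ∀ i₀ → (∀ i → i ≢ i₀ → f i ≡ 𝟘) → Unique L → ∃[ v ] (FinSum f L v × v ≤ f i₀)
  FinSum-single i₀ vanish [] = 𝟘 , [] , 𝟘-least _
  FinSum-single {f = f} {L = i ∷ _} i₀ vanish (i∉L ∷ u) with i ≟ i₀
  ... | yes refl = f i , ⇓-identityʳ _ ∷ FinSum-zero (All.map (λ i≢j → vanish _ (i≢j ∘ sym)) i∉L) , ≤-refl _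
  ... | no i≢i₀  = let v , P , v≤ = FinSum-single i₀ vanish u in v , ⇓-identityˡ-≡ (vanish i i≢i₀) ∷ P , v≤

  HasSum-single : ∀ i₀ → (∀ i → i ≢ i₀ → f i ≡ 𝟘) → HasSum f (f i₀)
  HasSum-single {f = f} i₀ vanish =
    (λ L u → let v , P , _ = FinSum-single i₀ vanish u in v , P) ,
    (λ v (L , u , P) → let v' , P' , v'≤ = FinSum-single i₀ vanish u in
       subst (_≤ f i₀) (FinSum-functional P' P) v'≤) ,
    (λ w ub → ub (f i₀) (i₀ ∷ [] , [] ∷ [] , ⇓-identityʳ _ ∷ []))

  HasSum-zero : (∀ i → f i ≡ 𝟘) → HasSum f 𝟘
  HasSum-zero f≡𝟘 =
    (λ L _ → 𝟘 , FinSum-zero (All.universal f≡𝟘 L)) ,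
    (λ v (L , _ , P) → ≤-reflexive (FinSum-functional P (FinSum-zero (All.universal f≡𝟘 L)))) ,
    (λ w ub → ub 𝟘 ([] , [] , []))

  HasSum-⊹ : (∀ i → f i ⊹ g i ⇓ h i) → HasSum f a → HasSum g b → HasSum h c → a ⊹ b ⇓ c
  HasSum-⊹ {f = f} {g} {h} {a} {b} {c} f+g Σf@(fsf , supf) Σg@(fsg , supg) Σh@(fsh , _ , lubh) =
    let t , a+b , t≤c = sup-⊹-≤ (PartialSum-directed fsf) supf λ x PSx →
          let s , b+x , s≤c = sup-⊹-≤ (PartialSum-directed fsg) supg λ y PSy →
                let z , x+y , z≤c = partial-sums-⊹ PSx PSy in z , ⇓-comm x+y , z≤c
          in s , ⇓-comm b+x , s≤c
    in subst (a ⊹ b ⇓_) (≤-antisym _ _ t≤c (c≤ a+b)) a+b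
    where
      partial-sums-⊹ : ∀ {x y} → PartialSum f x → PartialSum g y → ∃[ z ] (x ⊹ y ⇓ z × z ≤ c)
      partial-sums-⊹ (L₁ , u₁ , P₁) (L₂ , u₂ , P₂) =
        let L , u , L₁⊆L , L₂⊆L = ⊆-union L₁ L₂
            w , P = fsh L u
            _ , _ , Pf , Pg , x'+y' = FinSum-split f+g P
            z , x+y , z≤w = ⊹-mono-≤ (FinSum-⊆-≤ u₁ L₁⊆L u P₁ Pf) (FinSum-⊆-≤ u₂ L₂⊆L u P₂ Pg) x'+y'
        in z , x+y , ≤-trans z≤w (FinSum≤HasSum Σh u P)

      c≤ : ∀ {t} → a ⊹ b ⇓ t → c ≤ t
      c≤ {t} a+b = lubh t λ w (L , u , P) →
        let _ , _ , Pf , Pg , x+y = FinSum-split f+g P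
            z , x+y' , z≤t = ⊹-mono-≤ (FinSum≤HasSum Σf u Pf) (FinSum≤HasSum Σg u Pg) a+b
        in subst (_≤ t) (⇓-functional x+y' x+y) z≤t

  module _ {x : I → J → U} {y : I → U} where

    Fubini-finite : ∀ {c : J → U} L → (∀ i → HasSum (x i) (y i)) →
                         (∀ j → FinSum (λ i → x i j) L (c j)) → FinitelySummable c →
                         ∃[ v ] (FinSum y L v × HasSum c v)
    Fubini-finite [] Σrows cols _ = 𝟘 , [] , HasSum-zero (λ j → FinSum-[]⁻ (cols j))
    Fubini-finite {c} (i ∷ L) Σrows cols fsc =
      let v , P , Σc' = Fubini-finite L Σrows cols' (FinitelySummable-mono c'≤c fsc)
          s , Σc = HasSum-exists fsc
      in s , HasSum-⊹ head+c' (Σrows i) Σc' Σc ∷ P , Σc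
      where
        c' : J → U
        c' j = proj₁ (FinSum-∷⁻ (cols j))
        head+c' : ∀ j → x i j ⊹ c' j ⇓ c j
        head+c' j = proj₁ (proj₂ (FinSum-∷⁻ (cols j)))
        cols' : ∀ j → FinSum (λ i → x i j) L (c' j)
        cols' j = proj₂ (proj₂ (FinSum-∷⁻ (cols j)))
        c'≤c : ∀ j → c' j ≤ c j
        c'≤c j = ⇓⇒≤ʳ (head+c' j)

    Fubini-≤ : ∀ {z : J → U} → (∀ i → HasSum (x i) (y i)) → HasSum y s →
               (∀ j → HasSum (λ i → x i j) (z j)) → HasSum z t → s ≤ t
    Fubini-≤ {z = z} Σrows (_ , _ , lub) Σcols Σz = lub _ λ v (L , u , P) →
      let col≤z : ∀ j → proj₁ (proj₁ (Σcols j) L u) ≤ z j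
          col≤z j = FinSum≤HasSum (Σcols j) u (proj₂ (proj₁ (Σcols j) L u))
          v' , P' , Σc = Fubini-finite L Σrows (λ j → proj₂ (proj₁ (Σcols j) L u))
                                            (FinitelySummable-mono col≤z (proj₁ Σz))
      in subst (_≤ _) (FinSum-functional P' P) (HasSum-mono col≤z Σc Σz)

  Fubini : ∀ {x : I → J → U} {y : I → U} {z : J → U} → (∀ i → HasSum (x i) (y i)) → HasSum y s →
           (∀ j → HasSum (λ i → x i j) (z j)) → HasSum z s
  Fubini {x = x} {y} {z} Σrows Σy Σcols =
    let t , Σz = HasSum-exists fsz in
    subst (HasSum z) (≤-antisym _ _ (Fubini-≤ Σcols Σz Σrows Σy) (Fubini-≤ Σrows Σy Σcols Σz)) Σz
    where
      fsz : FinitelySummable z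
      fsz M u =
        let row≤y : ∀ i → proj₁ (proj₁ (Σrows i) M u) ≤ y i
            row≤y i = FinSum≤HasSum (Σrows i) u (proj₂ (proj₁ (Σrows i) M u))
            v , P , _ = Fubini-finite M Σcols (λ i → proj₂ (proj₁ (Σrows i) M u))
                                           (FinitelySummable-mono row≤y (proj₁ Σy))
        in v , P

  upTo-suc : ∀ N → upTo (suc N) ≡ 0 ∷ map suc (upTo N)
  upTo-suc N = cong (0 ∷_) (sym (map-upTo suc N))

  ⊆-upTo : (L : List ℕ) → ∃[ N ] (L ⊆ upTo N)
  ⊆-upTo [] = 0 , λ ()
  ⊆-upTo (n ∷ L) =
    let N , L⊆upToN = ⊆-upTo L in
    suc n ⊔ N , λ { (here refl) → ∈-upTo⁺ (m≤m⊔n (suc n) N)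
                  ; (there m∈L) → ∈-upTo⁺ (<-≤-trans (∈-upTo⁻ (L⊆upToN m∈L)) (m≤n⊔m (suc n) N)) }

  FinSum-upTo-suc⁻ : ∀ {N} → FinSum f (upTo (suc N)) s → ∃[ v ] (f 0 ⊹ v ⇓ s × FinSum (f ∘ suc) (upTo N) v)
  FinSum-upTo-suc⁻ {f = f} {s = s} {N = N} P =
    let v , f0+v , Q = FinSum-∷⁻ (subst (λ L → FinSum f L s) (upTo-suc N) P)
    in v , f0+v , FinSum-map⁻ suc (upTo N) Q

  FinSum-upTo-suc⁺ : ∀ {N} → f 0 ⊹ v ⇓ s → FinSum (f ∘ suc) (upTo N) v → FinSum f (upTo (suc N)) s
  FinSum-upTo-suc⁺ {f = f} {s = s} {N} f0+v P =
    subst (λ L → FinSum f L s) (sym (upTo-suc N)) (f0+v ∷ FinSum-map⁺ suc P)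

  PartialSum-below-prefix : FinitelySummable f → PartialSum f v →
                            ∃[ N ] ∃[ w ] (FinSum f (upTo N) w × v ≤ w)
  PartialSum-below-prefix fs (L , u , P) =
    let N , L⊆upToN = ⊆-upTo L
        w , Q = fs (upTo N) (upTo⁺ N)
    in N , w , Q , FinSum-⊆-≤ u L⊆upToN (upTo⁺ N) P Q

  HasSum-≤-prefixes : HasSum f s → (∀ {N w} → FinSum f (upTo N) w → w ≤ b) → s ≤ b
  HasSum-≤-prefixes (fs , _ , lub) bound = lub _ λ v PSv →
    let _ , _ , Q , v≤w = PartialSum-below-prefix fs PSv in ≤-trans v≤w (bound Q)

  HasSum-of-bounded-prefixes : (∀ N → ∃[ w ] (FinSum f (upTo N) w × w ≤ b)) → ∃[ s ] (HasSum f s × s ≤ b)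
  HasSum-of-bounded-prefixes {f = f} {b} prefixes =
    let s , Σf = HasSum-exists fs in
    s , Σf , HasSum-≤-prefixes Σf λ {N} Q →
      let _ , Q' , w≤b = prefixes N in subst (_≤ b) (FinSum-functional Q' Q) w≤b
    where
      fs : FinitelySummable f
      fs L u = let N , L⊆upToN = ⊆-upTo L
                   _ , Q , _ = prefixes N
                   v , P , _ = FinSum-⊆ u L⊆upToN (upTo⁺ N) Q
               in v , P

  HasSum-head : HasSum f s → HasSum (f ∘ suc) t → f 0 ⊹ t ⇓ s
  HasSum-head {f = f} {s} {t} Σf@(fsf , _) Σtail@(fstail , suptail) =
    let s' , t+f0 , s'≤s = sup-⊹-≤ (PartialSum-directed fstail) suptail head+partial
        f0+t = ⇓-comm t+f0
    in subst (f 0 ⊹ t ⇓_) (≤-antisym _ _ s'≤s (HasSum-≤-prefixes Σf (prefix≤ f0+t))) f0+t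
    where
      head+partial : ∀ y → PartialSum (f ∘ suc) y → ∃[ z ] (y ⊹ f 0 ⇓ z × z ≤ s)
      head+partial y PSy =
        let N , w , Q , y≤w = PartialSum-below-prefix fstail PSy
            u , P = fsf (upTo (suc N)) (upTo⁺ (suc N))
            _ , f0+w , Q' = FinSum-upTo-suc⁻ P
            z , f0+y , z≤u = ⊹-mono-≤ (≤-refl (f 0)) (subst (y ≤_) (FinSum-functional Q Q') y≤w) f0+w
        in z , ⇓-comm f0+y , ≤-trans z≤u (FinSum≤HasSum Σf (upTo⁺ (suc N)) P)

      prefix≤ : ∀ {s' N w} → f 0 ⊹ t ⇓ s' → FinSum f (upTo N) w → w ≤ s'
      prefix≤ {N = zero} f0+t [] = 𝟘-least _
      prefix≤ {N = suc N} f0+t P =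
        let _ , f0+w , Q = FinSum-upTo-suc⁻ P
            z , f0+w' , z≤s' = ⊹-mono-≤ (≤-refl _) (FinSum≤HasSum Σtail (upTo⁺ N) Q) f0+t
        in subst (_≤ _) (⇓-functional f0+w' f0+w) z≤s'

  FinitelySummable-weighted : ∀ {m : I → U} → HasSum m s → (x : I → U) → FinitelySummable (λ i → m i · x i)
  FinitelySummable-weighted {m = m} (fsm , _) x =
    FinitelySummable-mono (λ i → ·-monoʳ-≤ (m i) (proj₂ top (x i)))
      λ L u → let v , P = fsm L u in v · proj₁ top , FinSum-scaleʳ (proj₁ top) P

private
  next : ℕ × ℕ → ℕ × ℕ
  next (zero  , b) = suc b , zero
  next (suc a , b) = a , suc b

unpair : ℕ → ℕ × ℕ
unpair zero    = zero , zero
unpair (suc k) = next (unpair k)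

unpair-surjective : ∀ a b → ∃[ k ] (unpair k ≡ (a , b))
unpair-surjective a b = diagonal (a + b) a b refl
  where
    diagonal : ∀ d a b → a + b ≡ d → ∃[ k ] (unpair k ≡ (a , b))
    diagonal d a (suc b) a+b≡d =
      let k , eq = diagonal d (suc a) b (≡.trans (sym (+-suc a b)) a+b≡d) in suc k , cong next eq
    diagonal _ zero zero _ = zero , refl
    diagonal (suc d) (suc a) zero a+b≡d =
      let k , eq = diagonal d zero a (≡.trans (sym (+-identityʳ a)) (suc-injective a+b≡d))
      in suc k , cong next eq

module Weightings (em : ExcludedMiddle 0ℓ) (S : PartialSemiring) (St : Set) where
  open Weighting S St
  open PartialMonoid S
  open FiniteSums S
  open Sums em S

  private variable
    I : Set
    f : I → U
    L : List I
    s u : U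
    ρ σ τ : St
    m m' r r' : St → U
    p : St → St → U

  finSum⇒FinSum : ∀ L → finSum f L ≡ just s → FinSum f L s
  finSum⇒FinSum [] refl = []
  finSum⇒FinSum {f = f} (i ∷ L) eq =
    let _ , e , p = >>=-just⁻ (finSum f L) eq in p ∷ finSum⇒FinSum L e

  FinSum⇒finSum : FinSum f L s → finSum f L ≡ just s
  FinSum⇒finSum [] = refl
  FinSum⇒finSum (p ∷ P) rewrite FinSum⇒finSum P = p

  module _ {P : I → Set} (vanish : ∀ i → ¬ P i → f i ≡ 𝟘) where

    private
      P? : Decidable P
      P? _ = em

      restrict : ∀ {L} → Unique L → FinSum f L s → ∃[ L' ] (Unique L' × All P L' × finSum f L' ≡ just s)
      restrict {L = L} u Q =
        filter P? L , filter⁺ P? u , all-filter P? L , FinSum⇒finSum (FinSum-filter⁺ P? vanish Q)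

    IsSumOver⇒HasSum : IsSumOver P f s → HasSum f s
    IsSumOver⇒HasSum (def , ub , lub) =
      (λ L u → let v , e = def (filter P? L) (filter⁺ P? u) (all-filter P? L) in
         v , FinSum-filter⁻ P? vanish (finSum⇒FinSum _ e)) ,
      (λ v (L , u , Q) → ub v (restrict u Q)) ,
      (λ w ubw → lub w λ v (L , u , _ , e) → ubw v (L , u , finSum⇒FinSum L e))

    HasSum⇒IsSumOver : HasSum f s → IsSumOver P f s
    HasSum⇒IsSumOver (fs , ub , lub) =
      (λ L u _ → let v , Q = fs L u in v , FinSum⇒finSum Q) ,
      (λ v (L , u , _ , e) → ub v (L , u , finSum⇒FinSum L e)) ,
      (λ w ubw → lub w λ v (L , u , Q) → ubw v (restrict u Q))

  vanishes-off-⊤ : ∀ i → ¬ ⊤ → f i ≡ 𝟘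
  vanishes-off-⊤ _ ¬⊤ = contradiction tt ¬⊤

  vanishes-off-Supp : ∀ σ → ¬ Supp m σ → m σ ≡ 𝟘
  vanishes-off-Supp {m} σ ¬Supp with em {m σ ≡ 𝟘}
  ... | yes mσ≡𝟘 = mσ≡𝟘
  ... | no mσ≢𝟘  = contradiction mσ≢𝟘 ¬Supp

  IsW⇒HasSum : IsW m → ∃ (HasSum m)
  IsW⇒HasSum (_ , s , Σm) = s , IsSumOver⇒HasSum vanishes-off-Supp Σm

  HasSum⇒IsW : Countable (Supp m) → HasSum m s → IsW m
  HasSum⇒IsW {s = s} countable Σm = countable , s , HasSum⇒IsSumOver vanishes-off-Supp Σm

  private
    select : (Q : St → Set) → St → Maybe St
    select Q σ with em {Q σ}
    ... | yes _ = just σ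
    ... | no _  = nothing

    select-sound : ∀ Q {σ τ} → select Q σ ≡ just τ → Q τ
    select-sound Q {σ} eq with em {Q σ} | eq
    ... | yes q | refl = q

    select-complete : ∀ {Q σ} → Q σ → select Q σ ≡ just σ
    select-complete {Q} {σ} q with em {Q σ}
    ... | yes _ = refl
    ... | no ¬q = contradiction q ¬q

  Countable-⊆ : {P Q : St → Set} → (∀ σ → Q σ → P σ) → Countable P → Countable Q
  Countable-⊆ {Q = Q} Q⊆P (e , sound , complete) =
    (λ n → e n >>= select Q) ,
    (λ n τ eq → let _ , _ , selected = >>=-just⁻ (e n) eq in select-sound Q selected) ,
    (λ σ q → let n , eσ = complete σ (Q⊆P σ q) in
       n , ≡.trans (cong (_>>= select Q) eσ) (select-complete q))

  Countable-≡ : ∀ ρ → Countable (_≡ ρ)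
  Countable-≡ ρ = (λ _ → just ρ) , (λ _ _ eq → sym (just-injective eq)) , (λ σ σ≡ρ → 0 , cong just (sym σ≡ρ))

  Countable-⋃ : {P : St → Set} {Q : St → St → Set} → Countable P → (∀ σ → Countable (Q σ)) →
                Countable (λ τ → ∃[ σ ] (P σ × Q σ τ))
  Countable-⋃ {Q = Q} (e , sound , complete) countableQ =
    enum ∘ unpair ,
    (λ k τ eq → let σ , eσ , eτ = >>=-just⁻ (e (proj₁ (unpair k))) eq in
       σ , sound _ σ eσ , proj₁ (proj₂ (countableQ σ)) _ τ eτ) ,
    (λ τ (σ , Pσ , Qστ) →
       let n , eσ = complete σ Pσ
           j , eτ = proj₂ (proj₂ (countableQ σ)) τ Qστ
           k , unpair-k = unpair-surjective n j
       in k , (begin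
         enum (unpair k)                               ≡⟨ cong enum unpair-k ⟩
         (e n >>= λ σ' → proj₁ (countableQ σ') j)     ≡⟨ cong (_>>= λ σ' → proj₁ (countableQ σ') j) eσ ⟩
         proj₁ (countableQ σ) j                        ≡⟨ eτ ⟩
         just τ                                        ∎))
    where
      enum : ℕ × ℕ → Maybe St
      enum (n , j) = e n >>= λ σ → proj₁ (countableQ σ) j

  IsW-≤ : (∀ σ → m' σ ≤ m σ) → IsW m → IsW m'
  IsW-≤ {m'} {m} m'≤m mW@(countable , _) =
    let _ , Σm = IsW⇒HasSum mW
        _ , Σm' = HasSum-exists (FinitelySummable-mono m'≤m (proj₁ Σm))
    in HasSum⇒IsW (Countable-⊆ Supp-m'⊆Supp-m countable) Σm'
    where
      Supp-m'⊆Supp-m : ∀ σ → Supp m' σ → Supp m σ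
      Supp-m'⊆Supp-m σ m'σ≢𝟘 mσ≡𝟘 = m'σ≢𝟘 (≤𝟘⇒≡𝟘 (subst (m' σ ≤_) mσ≡𝟘 (m'≤m σ)))

  IsW-scaleˡ : ∀ u → IsW m → IsW (λ σ → u · m σ)
  IsW-scaleˡ u mW@(countable , _) =
    HasSum⇒IsW (Countable-⊆ (λ σ umσ≢𝟘 mσ≡𝟘 → umσ≢𝟘 (≡.trans (cong (u ·_) mσ≡𝟘) (zeroʳ u))) countable)
               (HasSum-scaleˡ u (proj₂ (IsW⇒HasSum mW)))

  η : St → St → U
  η ρ τ with τ ≟ ρ
  ... | yes _ = 𝟙
  ... | no _  = 𝟘

  η-diagonal : η ρ ρ ≡ 𝟙
  η-diagonal {ρ} with ρ ≟ ρ
  ... | yes _  = refl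
  ... | no ρ≢ρ = contradiction refl ρ≢ρ

  η-off-diagonal : τ ≢ ρ → η ρ τ ≡ 𝟘
  η-off-diagonal {τ} {ρ} τ≢ρ with τ ≟ ρ
  ... | yes τ≡ρ = contradiction τ≡ρ τ≢ρ
  ... | no _    = refl

  η-IsEta : ∀ ρ → IsEta ρ (η ρ)
  η-IsEta ρ = η-diagonal , λ τ → η-off-diagonal

  IsEta⇒≗η : IsEta ρ m → m ≗ η ρ
  IsEta⇒≗η {ρ} (mρ≡𝟙 , m-off) τ with τ ≟ ρ
  ... | yes refl = mρ≡𝟙
  ... | no τ≢ρ   = m-off τ τ≢ρ

  η-supp : Supp (η ρ) τ → τ ≡ ρ
  η-supp {ρ} {τ} supp with τ ≟ ρ
  ... | yes τ≡ρ = τ≡ρ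
  ... | no _    = contradiction refl supp

  η-comm : ∀ u → η ρ τ · u ≡ u · η ρ τ
  η-comm {ρ} {τ} u with τ ≟ ρ
  ... | yes _ = ≡.trans (·-identityˡ u) (sym (·-identityʳ u))
  ... | no _  = ≡.trans (zeroˡ u) (sym (zeroʳ u))

  η-IsW : ∀ ρ → IsW (η ρ)
  η-IsW ρ = HasSum⇒IsW (Countable-⊆ (λ _ → η-supp) (Countable-≡ ρ)) (HasSum-single ρ λ _ → η-off-diagonal)

  module _ {p : St → St → U} {m : St → U} where

    private
      weighted-vanishes : ∀ τ σ → ¬ Supp m σ → m σ · p σ τ ≡ 𝟘
      weighted-vanishes τ σ ¬Supp = ≡.trans (cong (_· p σ τ) (vanishes-off-Supp {m = m} σ ¬Supp)) (zeroˡ _)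

    IsBind⇒HasSum : IsBind p m r → ∀ τ → HasSum (λ σ → m σ · p σ τ) (r τ)
    IsBind⇒HasSum (_ , Σr) τ = IsSumOver⇒HasSum (weighted-vanishes τ) (Σr τ)

    HasSum⇒IsBind : IsW r → (∀ τ → HasSum (λ σ → m σ · p σ τ) (r τ)) → IsBind p m r
    HasSum⇒IsBind rW Σr = rW , λ τ → HasSum⇒IsSumOver (weighted-vanishes τ) (Σr τ)

    bind-unique : IsBind p m r → IsBind p m r' → r ≗ r'
    bind-unique b b' τ = HasSum-unique (IsBind⇒HasSum b τ) (IsBind⇒HasSum b' τ)

    bind-exists : (∀ σ → IsW (p σ)) → IsW m → ∃ (IsBind p m)
    bind-exists pW mW = m>>=p , HasSum⇒IsBind m>>=p-W Σm>>=p
      where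
        Σm : HasSum m (proj₁ (IsW⇒HasSum mW))
        Σm = proj₂ (IsW⇒HasSum mW)

        column : ∀ τ → ∃ (HasSum (λ σ → m σ · p σ τ))
        column τ = HasSum-exists (FinitelySummable-weighted Σm (λ σ → p σ τ))

        m>>=p : St → U
        m>>=p τ = proj₁ (column τ)

        Σm>>=p : ∀ τ → HasSum (λ σ → m σ · p σ τ) (m>>=p τ)
        Σm>>=p τ = proj₂ (column τ)

        Supp-m>>=p : ∀ τ → Supp m>>=p τ → ∃[ σ ] (Supp m σ × Supp (p σ) τ)
        Supp-m>>=p τ m>>=pτ≢𝟘 with em {∃[ σ ] (Supp m σ × Supp (p σ) τ)}
        ... | yes witness = witness
        ... | no ¬witness = contradiction (HasSum-unique (Σm>>=p τ) (HasSum-zero term≡𝟘)) m>>=pτ≢𝟘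
          where
            term≡𝟘 : ∀ σ → m σ · p σ τ ≡ 𝟘
            term≡𝟘 σ with em {m σ ≡ 𝟘}
            ... | yes mσ≡𝟘 = ≡.trans (cong (_· p σ τ) mσ≡𝟘) (zeroˡ _)
            ... | no mσ≢𝟘  = ≡.trans (cong (m σ ·_) pστ≡𝟘) (zeroʳ _)
              where
                pστ≡𝟘 : p σ τ ≡ 𝟘
                pστ≡𝟘 = vanishes-off-Supp {m = p σ} τ λ pστ≢𝟘 → ¬witness (σ , mσ≢𝟘 , pστ≢𝟘)

        mass : ∀ σ → ∃ (HasSum (p σ))
        mass σ = IsW⇒HasSum (pW σ)

        total : ∃ (HasSum (λ σ → m σ · proj₁ (mass σ)))
        total = HasSum-exists (FinitelySummable-weighted Σm (λ σ → proj₁ (mass σ)))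

        m>>=p-W : IsW m>>=p
        m>>=p-W = HasSum⇒IsW (Countable-⊆ Supp-m>>=p (Countable-⋃ (proj₁ mW) (λ σ → proj₁ (pW σ))))
                        (Fubini (λ σ → HasSum-scaleˡ (m σ) (proj₂ (mass σ))) (proj₂ total) Σm>>=p)

  bind-scaleˡ : ∀ {p : St → St → U} {m r} u → IsBind p m r → IsBind p (λ σ → u · m σ) (λ τ → u · r τ)
  bind-scaleˡ {p} {m} u b@(rW , _) = HasSum⇒IsBind (IsW-scaleˡ u rW) λ τ →
    HasSum-cong (λ σ → sym (·-assoc u (m σ) (p σ τ))) (HasSum-scaleˡ u (IsBind⇒HasSum b τ))

  bind-η : ∀ {p : St → St → U} ρ → IsW (p ρ) → IsBind p (η ρ) (p ρ)
  bind-η {p} ρ pρW = HasSum⇒IsBind pρW λ τ →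
    subst (HasSum _) (≡.trans (cong (_· p ρ τ) η-diagonal) (·-identityˡ _))
          (HasSum-single ρ λ σ σ≢ρ → ≡.trans (cong (_· p σ τ) (η-off-diagonal σ≢ρ)) (zeroˡ _))

  bind-assoc : ∀ {p q pq : St → St → U} {m r s s'} → IsBind p m r → IsBind q r s →
               (∀ ρ → IsBind q (p ρ) (pq ρ)) → IsBind pq m s' → s ≗ s'
  bind-assoc {p} {q} {pq} {m} m>>=p r>>=q p>>=q m>>=pq υ =
    HasSum-unique (IsBind⇒HasSum r>>=q υ)
      (Fubini (λ ρ → HasSum-scaleˡ (m ρ) (IsBind⇒HasSum (p>>=q ρ) υ)) (IsBind⇒HasSum m>>=pq υ)
              (λ τ → HasSum-cong (λ ρ → ·-assoc (m ρ) (p ρ τ) (q τ υ))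
                                 (HasSum-scaleʳ (q τ υ) (IsBind⇒HasSum m>>=p τ))))

  IsBind-cong : ∀ {p p' : St → St → U} {m m' r r'} → (∀ σ τ → p σ τ ≡ p' σ τ) → m ≗ m' → r ≗ r' →
                IsBind p m r → IsBind p' m' r'
  IsBind-cong {r = r} {r'} p≗p' m≗m' r≗r' b@(rW , _) = HasSum⇒IsBind (IsW-ext r r' r≗r' rW) λ τ →
    subst (HasSum _) (r≗r' τ) (HasSum-cong (λ σ → cong₂ _·_ (m≗m' σ) (p≗p' σ τ)) (IsBind⇒HasSum b τ))

module Completeness (em : ExcludedMiddle 0ℓ) (S : PartialSemiring) (St Act : Set)
                    (⟦_⟧ₐ : Act → St → St → PartialSemiring.U S) where
  open Language S St Act ⟦_⟧ₐ
  open PartialMonoid S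
  open FiniteSums S
  open Sums em S
  open Weightings em S St

  singletonᴬ : (m : St → U) → IsW m → Assertion
  singletonᴬ m mW = record
    { _∋_ = _≗ m
    ; inW = λ m' m'≗m → IsW-ext m m' (sym ∘ m'≗m) mW
    ; ext = λ m₁ m₂ m₁≗m₂ m₁≗m σ → ≡.trans (sym (m₁≗m₂ σ)) (m₁≗m σ) }

  weaken-post : ∀ {φ C ψ ψ'} → Ω ⊢⟨ φ ⟩ C ⟨ ψ ⟩ → ψ ⊆ᴬ ψ' → Ω ⊢⟨ φ ⟩ C ⟨ ψ' ⟩
  weaken-post = consR (λ _ m∈φ → m∈φ)

  DerivableOnPoints : Prog → (f : St → St → U) → IsKernel f → Set₁
  DerivableOnPoints C f fW = ∀ ρ → Ω ⊢⟨ singletonᴬ (η ρ) (η-IsW ρ) ⟩ C ⟨ singletonᴬ (f ρ) (fW ρ) ⟩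

  module _ {C f} (fW : IsKernel f) (points : DerivableOnPoints C f fW) where

    derivable-singleton : ∀ {m r} (mW : IsW m) (rW : IsW r) → IsBind f m r →
                          Ω ⊢⟨ singletonᴬ m mW ⟩ C ⟨ singletonᴬ r rW ⟩
    derivable-singleton {m} {r} mW rW m>>=f =
      consR decompose
            (choiceR St (λ σ → m σ ⊙ᴬ point σ) (λ σ → m σ ⊙ᴬ image σ) (λ σ → scaleR (m σ) (points σ)))
            recompose
      where
        point image : St → Assertion
        point σ = singletonᴬ (η σ) (η-IsW σ)
        image σ = singletonᴬ (f σ) (fW σ)

        decompose : singletonᴬ m mW ⊆ᴬ ⨁ᴬ St (λ σ → m σ ⊙ᴬ point σ)
        decompose m' m'≗m =
          (λ σ τ → m σ · η σ τ) ,
          (λ σ → IsW-scaleˡ (m σ) (η-IsW σ) , η σ , (λ _ → refl) , (λ _ → refl)) ,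
          IsW-ext m m' (sym ∘ m'≗m) mW ,
          λ τ → HasSum⇒IsSumOver vanishes-off-⊤ (subst (HasSum _) (diagonal τ) (HasSum-single τ (off-diagonal τ)))
          where
            diagonal : ∀ τ → m τ · η τ τ ≡ m' τ
            diagonal τ = ≡.trans (cong (m τ ·_) η-diagonal) (≡.trans (·-identityʳ _) (sym (m'≗m τ)))
            off-diagonal : ∀ τ σ → σ ≢ τ → m σ · η σ τ ≡ 𝟘
            off-diagonal τ σ σ≢τ = ≡.trans (cong (m σ ·_) (η-off-diagonal (σ≢τ ∘ sym))) (zeroʳ _)

        recompose : ⨁ᴬ St (λ σ → m σ ⊙ᴬ image σ) ⊆ᴬ singletonᴬ r rW
        recompose r' (ms , ms∈ , _ , Σms) τ =
          HasSum-unique (HasSum-cong summand (IsSumOver⇒HasSum vanishes-off-⊤ (Σms τ))) (IsBind⇒HasSum m>>=f τ)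
          where
            summand : ∀ σ → ms σ τ ≡ m σ · f σ τ
            summand σ = let _ , _ , m'≗fσ , ms≡ = ms∈ σ in ≡.trans (ms≡ τ) (cong (m σ ·_) (m'≗fσ τ))

    derivable-from-points : ∀ φ ψ → (∀ m → φ ∋ m → ∃[ r ] (IsBind f m r × ψ ∋ r)) → Ω ⊢⟨ φ ⟩ C ⟨ ψ ⟩
    derivable-from-points φ ψ valid =
      consR (λ m m∈φ → (m , m∈φ) , λ _ → refl) (existsR (∃ (φ ∋_)) singleton (λ _ → ψ) derivable) (λ _ → proj₂)
      where
        singleton : ∃ (φ ∋_) → Assertion
        singleton (m , m∈φ) = singletonᴬ m (inW φ m m∈φ)

        derivable : ∀ t → Ω ⊢⟨ singleton t ⟩ C ⟨ ψ ⟩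
        derivable (m , m∈φ) =
          let r , m>>=f , r∈ψ = valid m m∈φ in
          weaken-post (derivable-singleton (inW φ m m∈φ) (inW ψ r r∈ψ) m>>=f)
                      (λ r' r'≗r → ext ψ r r' (sym ∘ r'≗r) r∈ψ)

  derivable-skip : ∀ {f} (fW : IsKernel f) → SemR skip f → DerivableOnPoints skip f fW
  derivable-skip fW f-IsEta ρ =
    weaken-post skipR λ m m≗ηρ τ → ≡.trans (m≗ηρ τ) (sym (IsEta⇒≗η (f-IsEta ρ) τ))

  derivable-act : ∀ {a f} (fW : IsKernel f) → SemR (act a) f → DerivableOnPoints (act a) f fW
  derivable-act {f = f} fW f≡⟦a⟧ ρ = ax (valid-act λ f' (_ , f'≡⟦a⟧) m m≗ηρ →
    f ρ ,
    IsBind-cong (λ σ τ → ≡.trans (f≡⟦a⟧ σ τ) (sym (f'≡⟦a⟧ σ τ))) (sym ∘ m≗ηρ) (λ _ → refl) (bind-η ρ (fW ρ)) ,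
    λ _ → refl)

  derivable-assume : ∀ {e f} (fW : IsKernel f) → SemR (assume e) f → DerivableOnPoints (assume e) f fW
  derivable-assume {e} {f} fW f-scaled-η ρ = weaken-post (assumeR guard-constant) scaled⊆
    where
      guard-constant : singletonᴬ (η ρ) (η-IsW ρ) ⊨ e ≐ ⟦ e ⟧ₑ ρ
      guard-constant m m≗ηρ σ mσ≢𝟘 = cong ⟦ e ⟧ₑ (η-supp λ ηρσ≡𝟘 → mσ≢𝟘 (≡.trans (m≗ηρ σ) ηρσ≡𝟘))

      scaled⊆ : (singletonᴬ (η ρ) (η-IsW ρ) ᴬ⊙ ⟦ e ⟧ₑ ρ) ⊆ᴬ singletonᴬ (f ρ) (fW ρ)
      scaled⊆ r (_ , m , m≗ηρ , r≡m·e) τ = let η' , η'-IsEta , fρ≡e·η' = f-scaled-η ρ in begin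
        r τ               ≡⟨ r≡m·e τ ⟩
        m τ · ⟦ e ⟧ₑ ρ    ≡⟨ cong (_· ⟦ e ⟧ₑ ρ) (m≗ηρ τ) ⟩
        η ρ τ · ⟦ e ⟧ₑ ρ  ≡⟨ η-comm (⟦ e ⟧ₑ ρ) ⟩
        ⟦ e ⟧ₑ ρ · η ρ τ  ≡⟨ cong (⟦ e ⟧ₑ ρ ·_) (sym (IsEta⇒≗η η'-IsEta τ)) ⟩
        ⟦ e ⟧ₑ ρ · η' τ   ≡⟨ sym (fρ≡e·η' τ) ⟩
        f ρ τ             ∎

  derivable-seq : ∀ {C₁ C₂ f₁ f₂ f} (f₁W : IsKernel f₁) (f₂W : IsKernel f₂) (fW : IsKernel f) →
                  DerivableOnPoints C₁ f₁ f₁W → DerivableOnPoints C₂ f₂ f₂W →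
                  (∀ σ → IsBind f₂ (f₁ σ) (f σ)) → DerivableOnPoints (C₁ ⨾ C₂) f fW
  derivable-seq f₁W f₂W fW points₁ points₂ f₁>>=f₂ ρ =
    seqR (points₁ ρ) (derivable-singleton f₂W points₂ (f₁W ρ) (fW ρ) (f₁>>=f₂ ρ))

  derivable-plus : ∀ {C₁ C₂ f₁ f₂ f} (f₁W : IsKernel f₁) (f₂W : IsKernel f₂) (fW : IsKernel f) →
                   DerivableOnPoints C₁ f₁ f₁W → DerivableOnPoints C₂ f₂ f₂W →
                   (∀ σ → IsPlus (f₁ σ) (f₂ σ) (f σ)) → DerivableOnPoints (C₁ ⊕ C₂) f fW
  derivable-plus f₁W f₂W fW points₁ points₂ f₁+f₂ ρ =
    weaken-post (plusR (points₁ ρ) (points₂ ρ)) λ r (m₁ , m₂ , m₁≗ , m₂≗ , _ , m₁+m₂) τ →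
      ⇓-functional (subst₂ (λ x y → x ⊹ y ⇓ r τ) (m₁≗ τ) (m₂≗ τ) (m₁+m₂ τ)) (proj₂ (f₁+f₂ ρ) τ)

  guard : Expr → St → St → U
  guard x ρ τ = ⟦ x ⟧ₑ ρ · η ρ τ

  guard-W : ∀ x → IsKernel (guard x)
  guard-W x ρ = IsW-scaleˡ (⟦ x ⟧ₑ ρ) (η-IsW ρ)

  guard-points : ∀ x → DerivableOnPoints (assume x) (guard x) (guard-W x)
  guard-points x = derivable-assume (guard-W x) λ ρ → η ρ , η-IsEta ρ , λ _ → refl

  module Loop {C e e' g h} (gW : IsKernel g) (points : DerivableOnPoints C g gW)
              (hW : IsKernel h) (h-lfp : IsLFP g e e' h) where

    body : St → St → U
    body ρ τ = ⟦ e ⟧ₑ ρ · g ρ τ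

    body-W : IsKernel body
    body-W ρ = IsW-scaleˡ (⟦ e ⟧ₑ ρ) (gW ρ)

    body-points : DerivableOnPoints (assume e ⨾ C) body body-W
    body-points = derivable-seq (guard-W e) gW body-W (guard-points e) points
                    (λ ρ → bind-scaleˡ (⟦ e ⟧ₑ ρ) (bind-η ρ (gW ρ)))

    Φ-Fixed : (St → St → U) → Set
    Φ-Fixed k = ∀ ρ τ → ∃[ v ] (HasSum (λ υ → body ρ υ · k υ τ) v × guard e' ρ τ ⊹ v ⇓ k ρ τ)

    private
      body-then : ∀ {k b ρ τ} → IsBind k (g ρ) b → HasSum (λ υ → body ρ υ · k υ τ) (⟦ e ⟧ₑ ρ · b τ)
      body-then {k} {ρ = ρ} {τ} g>>=k =
        HasSum-cong (λ υ → sym (·-assoc (⟦ e ⟧ₑ ρ) (g ρ υ) (k υ τ)))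
                    (HasSum-scaleˡ (⟦ e ⟧ₑ ρ) (IsBind⇒HasSum g>>=k τ))

    IsΦ⇒Φ-Fixed : ∀ {k} → IsΦ g e e' k k → Φ-Fixed k
    IsΦ⇒Φ-Fixed Φk ρ τ =
      let b , η' , g>>=k , η'-IsEta , Φk≡ = Φk ρ in
      ⟦ e ⟧ₑ ρ · b τ , body-then g>>=k ,
      ⇓-comm (subst (λ x → _ ⊹ ⟦ e' ⟧ₑ ρ · x ⇓ _) (IsEta⇒≗η η'-IsEta τ) (Φk≡ τ))

    Φ-Fixed⇒IsΦ : ∀ {k} → IsKernel k → Φ-Fixed k → IsΦ g e e' k k
    Φ-Fixed⇒IsΦ kW fixed ρ =
      let b , g>>=k = bind-exists kW (gW ρ) in
      b , η ρ , g>>=k , η-IsEta ρ , λ τ →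
        let v , Σv , exit+v = fixed ρ τ in
        ⇓-comm (subst (λ x → guard e' ρ τ ⊹ x ⇓ _) (HasSum-unique Σv (body-then g>>=k)) exit+v)

    -- unroll n is the kernel of (assume e ⨾ C)ⁿ ⨾ assume e'.
    unrolling : ℕ → ∃ IsKernel
    unrolling zero    = guard e' , guard-W e'
    unrolling (suc n) = (λ ρ → proj₁ (step ρ)) , (λ ρ → proj₁ (proj₂ (step ρ)))
      where
        step : ∀ ρ → ∃ (IsBind (proj₁ (unrolling n)) (body ρ))
        step ρ = bind-exists (proj₂ (unrolling n)) (body-W ρ)

    unroll : ℕ → St → St → U
    unroll n = proj₁ (unrolling n)

    unroll-W : ∀ n → IsKernel (unroll n)
    unroll-W n = proj₂ (unrolling n)

    unroll-step : ∀ n ρ → IsBind (unroll n) (body ρ) (unroll (suc n) ρ)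
    unroll-step n ρ = proj₂ (bind-exists (unroll-W n) (body-W ρ))

    h-fixed : Φ-Fixed h
    h-fixed = IsΦ⇒Φ-Fixed (proj₁ h-lfp)

    unroll-prefix≤ : ∀ N ρ τ → ∃[ w ] (FinSum (λ n → unroll n ρ τ) (upTo N) w × w ≤ h ρ τ)
    unroll-prefix≤ zero    ρ τ = 𝟘 , [] , 𝟘-least _
    unroll-prefix≤ (suc N) ρ τ =
      let V , ΣV , exit+V = h-fixed ρ τ
          v , P , Σc = Fubini-finite (upTo N) (λ n → IsBind⇒HasSum (unroll-step n ρ) τ) partial
                                          (FinitelySummable-mono c≤ (proj₁ ΣV))
          w , exit+v , w≤h = ⊹-mono-≤ (≤-refl _) (HasSum-mono c≤ Σc ΣV) exit+V
      in w , FinSum-upTo-suc⁺ exit+v P , w≤h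
      where
        prefix : ∀ υ → ∃[ w ] (FinSum (λ n → unroll n υ τ) (upTo N) w × w ≤ h υ τ)
        prefix υ = unroll-prefix≤ N υ τ
        c : St → U
        c υ = body ρ υ · proj₁ (prefix υ)
        partial : ∀ υ → FinSum (λ n → body ρ υ · unroll n υ τ) (upTo N) (c υ)
        partial υ = FinSum-scaleˡ (body ρ υ) (proj₁ (proj₂ (prefix υ)))
        c≤ : ∀ υ → c υ ≤ (body ρ υ · h υ τ)
        c≤ υ = ·-monoʳ-≤ (body ρ υ) (proj₂ (proj₂ (prefix υ)))

    private
      bounded-sum : ∀ ρ τ → ∃[ s ] (HasSum (λ n → unroll n ρ τ) s × s ≤ h ρ τ)
      bounded-sum ρ τ = HasSum-of-bounded-prefixes (λ N → unroll-prefix≤ N ρ τ)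

    ∑unroll : St → St → U
    ∑unroll ρ τ = proj₁ (bounded-sum ρ τ)

    ∑unroll-HasSum : ∀ ρ τ → HasSum (λ n → unroll n ρ τ) (∑unroll ρ τ)
    ∑unroll-HasSum ρ τ = proj₁ (proj₂ (bounded-sum ρ τ))

    ∑unroll≤h : ∀ ρ τ → ∑unroll ρ τ ≤ h ρ τ
    ∑unroll≤h ρ τ = proj₂ (proj₂ (bounded-sum ρ τ))

    ∑unroll-W : IsKernel ∑unroll
    ∑unroll-W ρ = IsW-≤ (∑unroll≤h ρ) (hW ρ)

    ∑unroll-fixed : Φ-Fixed ∑unroll
    ∑unroll-fixed ρ τ =
      let _ , Σh , _ = h-fixed ρ τ
          V , ΣV = HasSum-exists (FinitelySummable-mono (λ υ → ·-monoʳ-≤ (body ρ υ) (∑unroll≤h υ τ)) (proj₁ Σh))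
          Σtail = Fubini (λ υ → HasSum-scaleˡ (body ρ υ) (∑unroll-HasSum υ τ)) ΣV
                         (λ n → IsBind⇒HasSum (unroll-step n ρ) τ)
      in V , ΣV , HasSum-head (∑unroll-HasSum ρ τ) Σtail

    unroll-HasSum : ∀ ρ τ → HasSum (λ n → unroll n ρ τ) (h ρ τ)
    unroll-HasSum ρ τ = subst (HasSum _) (≤-antisym _ _ (∑unroll≤h ρ τ) h≤∑unroll) (∑unroll-HasSum ρ τ)
      where
        h≤∑unroll : h ρ τ ≤ ∑unroll ρ τ
        h≤∑unroll = proj₂ h-lfp ∑unroll ∑unroll-W (Φ-Fixed⇒IsΦ ∑unroll-W ∑unroll-fixed) ρ τ

    module _ (σ : St) where

      -- From m ∈ after n, k more rounds and the exit yield what n + k rounds yield from σ.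
      after : ℕ → Assertion
      after n = record
        { _∋_ = λ m → IsW m × (∀ k {r} → IsBind (unroll k) m r → r ≗ unroll (n + k) σ)
        ; inW = λ _ → proj₁
        ; ext = λ m m' m≗m' (mW , runs) → IsW-ext m m' m≗m' mW , λ k m'>>=unroll →
                  runs k (IsBind-cong (λ _ _ → refl) (sym ∘ m≗m') (λ _ → refl) m'>>=unroll) }

      start : singletonᴬ (η σ) (η-IsW σ) ⊆ᴬ after 0
      start m m≗ησ = IsW-ext (η σ) m (sym ∘ m≗ησ) (η-IsW σ) , λ k m>>=unroll →
        bind-unique m>>=unroll (IsBind-cong (λ _ _ → refl) (sym ∘ m≗ησ) (λ _ → refl) (bind-η σ (unroll-W k σ)))

      iterate : ∀ n → Ω ⊢⟨ after n ⟩ assume e ⨾ C ⟨ after (suc n) ⟩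
      iterate n = derivable-from-points body-W body-points _ _ λ m (mW , runs) →
        let r , m>>=body = bind-exists body-W mW in
        r , m>>=body , proj₁ m>>=body , λ k {r'} r>>=unroll τ →
          let _ , m>>=unroll = bind-exists (unroll-W (suc k)) mW in begin
            r' τ                      ≡⟨ bind-assoc m>>=body r>>=unroll (unroll-step k) m>>=unroll τ ⟩
            _                         ≡⟨ runs (suc k) m>>=unroll τ ⟩
            unroll (n + suc k) σ τ    ≡⟨ cong (λ j → unroll j σ τ) (+-suc n k) ⟩
            unroll (suc n + k) σ τ    ∎

      leave : ∀ n → Ω ⊢⟨ after n ⟩ assume e' ⟨ singletonᴬ (unroll n σ) (unroll-W n σ) ⟩
      leave n = derivable-from-points (guard-W e') (guard-points e') _ _ λ m (mW , runs) →
        let r , m>>=exit = bind-exists (guard-W e') mW in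
        r , m>>=exit , λ τ → ≡.trans (runs 0 m>>=exit τ) (cong (λ j → unroll j σ τ) (+-identityʳ n))

      converges : Converges (λ n → singletonᴬ (unroll n σ) (unroll-W n σ)) (singletonᴬ (h σ) (hW σ))
      converges ms ms≗unroll =
        h σ ,
        (hW σ , λ τ → HasSum⇒IsSumOver vanishes-off-⊤
                        (HasSum-cong (λ n → sym (ms≗unroll n τ)) (unroll-HasSum σ τ))) ,
        λ _ → refl

    derivable-iter : DerivableOnPoints (iter C e e') h hW
    derivable-iter σ =
      consR (start σ) (iterR (after σ) (λ n → singletonᴬ (unroll n σ) (unroll-W n σ)) (singletonᴬ (h σ) (hW σ))
                             (converges σ) (iterate σ) (leave σ))
            (λ _ m≗hσ → m≗hσ)

  derivable-on-points : ∀ C {f} (fW : IsKernel f) → SemR C f → DerivableOnPoints C f fW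
  derivable-on-points skip fW sem = derivable-skip fW sem
  derivable-on-points (C₁ ⨾ C₂) fW (_ , _ , f₁W , sem₁ , f₂W , sem₂ , f₁>>=f₂) =
    derivable-seq f₁W f₂W fW (derivable-on-points C₁ f₁W sem₁) (derivable-on-points C₂ f₂W sem₂) f₁>>=f₂
  derivable-on-points (C₁ ⊕ C₂) fW (_ , _ , f₁W , sem₁ , f₂W , sem₂ , f₁+f₂) =
    derivable-plus f₁W f₂W fW (derivable-on-points C₁ f₁W sem₁) (derivable-on-points C₂ f₂W sem₂) f₁+f₂
  derivable-on-points (assume e) fW sem = derivable-assume fW sem
  derivable-on-points (iter C e e') fW (_ , gW , sem , h-lfp) =
    Loop.derivable-iter gW (derivable-on-points C gW sem) fW h-lfp
  derivable-on-points (act a) fW sem = derivable-act fW sem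

  relative-completeness : (C : Prog) → WellFormed C → (φ ψ : Assertion) → Valid φ C ψ → Ω ⊢⟨ φ ⟩ C ⟨ ψ ⟩
  relative-completeness C (f , fW , sem) φ ψ valid =
    derivable-from-points fW (derivable-on-points C fW sem) φ ψ (valid f (fW , sem))

theorem3p7 : ExcludedMiddle 0ℓ →
    (S : PartialSemiring) (St Act : Set)
    (⟦_⟧ₐ : Act → St → St → PartialSemiring.U S) →
    (∀ a σ → Weighting.IsW S St (⟦ a ⟧ₐ σ)) →
    let open Language S St Act ⟦_⟧ₐ in
    (C : Prog) → WellFormed C →
    (φ ψ : Assertion) → Valid φ C ψ → Ω ⊢⟨ φ ⟩ C ⟨ ψ ⟩
theorem3p7 em S St Act ⟦_⟧ₐ _ = Completeness.relative-completeness em S St Act ⟦_⟧ₐ
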